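{- Let $r,s,b$ be integers with $s\ne0$ and $b\ge1$. Set $\alpha:=r/s$, $c:=\gcd(r,s,b)$, $b':=b/c$, $s':=s/c$, and assume $\gcd(s',b')=1$. Then $$\gamma:=D_{b'}(\alpha)+\frac{\lfloor1-\alpha\rfloor}{b'}\in(0,1].$$
   Context: For a positive integer $m$ and a rational $\alpha$ whose reduced denominator is coprime to $m$, $D_m(\alpha)$ is the unique rational with reduced denominator coprime to $m$ such that $mD_m(\alpha)-\alpha\in\{0,\dots,m-1\}$. (Under the hypotheses, the reduced denominator of $\alpha$ divides $s'$, hence is coprime to $b'$.) -}

module Defs where

open import Data.Nat as ℕ using (ℕ; zero; suc)
open import Data.Nat.Coprimality using (Coprime)
open import Data.Integer as ℤ using (ℤ; +_; -[1+_])
open import Data.Rational as ℚ using (ℚ; _/_; ↧ₙ_; 0ℚ)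
open import Data.Product using (Σ; _×_)
open import Relation.Binary.PropositionalEquality using (_≡_)

-- The rational number r / s for integers r, s (with s ≠ 0; the value at
-- s = 0 is an irrelevant junk value 0).
_÷_ : ℤ → ℤ → ℚ
r ÷ (+ zero) = 0ℚ
r ÷ (+ suc n) = r / suc n
r ÷ -[1+ n ] = (ℤ.- r) / suc n

-- IsD m α δ  :  δ is D_m(α), i.e. δ is a rational whose reduced
-- denominator is coprime to m and  m δ - α ∈ {0, …, m-1}.
IsD : ℕ → ℚ → ℚ → Set
IsD m α δ =
  Coprime (↧ₙ δ) m × Σ ℕ (λ k → (k ℕ.< m) × ((+ m / 1) ℚ.* δ ℚ.- α ≡ + k / 1))

{-# OPTIONS --safe #-}
module Submission where

-- If m δ − α = k with 0 ≤ k < m, then m (δ + ⌊1 − α⌋ / m) = (α + ⌊1 − α⌋) + k,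
-- and α + ⌊1 − α⌋ lies in (0, 1]; hence the left side lies in (0, m].
-- For existence, cancel c to write α = r′ / s′ with s′ coprime to b′, solve
-- k s′ ≡ −r′ (mod b′) with 0 ≤ k < b′ by Bézout, and take δ = t / s′ where
-- b′ t = r′ + k s′; the reduced denominator of δ divides s′.

open import Data.Empty using (⊥-elim)
open import Data.Nat as ℕ using (ℕ; zero; suc)
import Data.Nat.Properties as ℕP
open import Data.Nat.Coprimality as ℕC using (Coprime)
import Data.Nat.Divisibility as ℕD
import Data.Nat.GCD as ℕG
open import Data.Integer as ℤ using (ℤ; +_; -[1+_]; ∣_∣)
import Data.Integer.Properties as ℤP
import Data.Integer.DivMod as ℤD
import Data.Integer.Divisibility.Signed as ℤS
open import Data.Integer.GCD using (gcd; gcd-zeroʳ; gcd[i,j]∣i)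
open import Data.Integer.Tactic.RingSolver using (solve-∀)
open import Data.Rational as ℚ using (ℚ; 0ℚ; 1ℚ; floor; _/_; ↥_; ↧_; ↧ₙ_; mkℚ; toℚᵘ)
import Data.Rational.Properties as ℚP
open import Data.Rational.Solver using (module +-*-Solver)
import Data.Rational.Unnormalised as ℚᵘ
import Data.Rational.Unnormalised.Properties as ℚᵘP
open import Data.Product using (Σ; _×_; _,_)
open import Relation.Binary.PropositionalEquality
open import Defs

open +-*-Solver using (solve; _:=_; _:+_; _:*_; _:-_; con)

fromℤ : ℤ → ℚ
fromℤ z = z / 1

toℚᵘ-fromℤ : ∀ z → toℚᵘ (fromℤ z) ℚᵘ.≃ ℚᵘ.mkℚᵘ z 0
toℚᵘ-fromℤ z = ℚP.toℚᵘ-fromℚᵘ (ℚᵘ.mkℚᵘ z 0)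

fromℤ-homo-+ : ∀ a b → fromℤ (a ℤ.+ b) ≡ fromℤ a ℚ.+ fromℤ b
fromℤ-homo-+ a b = ℚP.toℚᵘ-injective (begin
  toℚᵘ (fromℤ (a ℤ.+ b))                    ≈⟨ toℚᵘ-fromℤ (a ℤ.+ b) ⟩
  ℚᵘ.mkℚᵘ (a ℤ.+ b) 0                       ≈⟨ ℚᵘ.*≡* (identity a b) ⟩
  ℚᵘ.mkℚᵘ a 0 ℚᵘ.+ ℚᵘ.mkℚᵘ b 0              ≈⟨ ℚᵘP.+-cong (toℚᵘ-fromℤ a) (toℚᵘ-fromℤ b) ⟨
  toℚᵘ (fromℤ a) ℚᵘ.+ toℚᵘ (fromℤ b)        ≈⟨ ℚP.toℚᵘ-homo-+ (fromℤ a) (fromℤ b) ⟨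
  toℚᵘ (fromℤ a ℚ.+ fromℤ b)                ∎)
  where
  open ℚᵘP.≃-Reasoning
  identity : ∀ a b → (a ℤ.+ b) ℤ.* + 1 ≡ (a ℤ.* + 1 ℤ.+ b ℤ.* + 1) ℤ.* + 1
  identity = solve-∀

fromℤ-homo-* : ∀ a b → fromℤ (a ℤ.* b) ≡ fromℤ a ℚ.* fromℤ b
fromℤ-homo-* a b = ℚP.toℚᵘ-injective (begin
  toℚᵘ (fromℤ (a ℤ.* b))                    ≈⟨ toℚᵘ-fromℤ (a ℤ.* b) ⟩
  ℚᵘ.mkℚᵘ (a ℤ.* b) 0                       ≈⟨ ℚᵘP.*-cong (toℚᵘ-fromℤ a) (toℚᵘ-fromℤ b) ⟨
  toℚᵘ (fromℤ a) ℚᵘ.* toℚᵘ (fromℤ b)        ≈⟨ ℚP.toℚᵘ-homo-* (fromℤ a) (fromℤ b) ⟨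
  toℚᵘ (fromℤ a ℚ.* fromℤ b)                ∎)
  where open ℚᵘP.≃-Reasoning

fromℤ-homo‿- : ∀ a → fromℤ (ℤ.- a) ≡ ℚ.- fromℤ a
fromℤ-homo‿- a = ℚP.toℚᵘ-injective (begin
  toℚᵘ (fromℤ (ℤ.- a))                      ≈⟨ toℚᵘ-fromℤ (ℤ.- a) ⟩
  ℚᵘ.mkℚᵘ (ℤ.- a) 0                         ≈⟨ ℚᵘP.-‿cong (toℚᵘ-fromℤ a) ⟨
  ℚᵘ.- toℚᵘ (fromℤ a)                       ≈⟨ ℚP.toℚᵘ-homo‿- (fromℤ a) ⟨
  toℚᵘ (ℚ.- fromℤ a)                        ∎)
  where open ℚᵘP.≃-Reasoning

↥-fromℤ : ∀ z → ↥ fromℤ z ≡ z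
↥-fromℤ z = begin
  ↥ fromℤ z                 ≡⟨ ℤP.*-identityʳ (↥ fromℤ z) ⟨
  ↥ fromℤ z ℤ.* + 1         ≡⟨ cong (↥ fromℤ z ℤ.*_) (gcd-zeroʳ z) ⟨
  ↥ fromℤ z ℤ.* gcd z (+ 1) ≡⟨ ℚP.↥-/ z 1 ⟩
  z                         ∎
  where open ≡-Reasoning

↧-fromℤ : ∀ z → ↧ fromℤ z ≡ + 1
↧-fromℤ z = begin
  ↧ fromℤ z                 ≡⟨ ℤP.*-identityʳ (↧ fromℤ z) ⟨
  ↧ fromℤ z ℤ.* + 1         ≡⟨ cong (↧ fromℤ z ℤ.*_) (gcd-zeroʳ z) ⟨
  ↧ fromℤ z ℤ.* gcd z (+ 1) ≡⟨ ℚP.↧-/ z 1 ⟩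
  + 1                       ∎
  where open ≡-Reasoning

fromℤ-injective : ∀ {a b} → fromℤ a ≡ fromℤ b → a ≡ b
fromℤ-injective {a} {b} eq = trans (sym (↥-fromℤ a)) (trans (cong ↥_ eq) (↥-fromℤ b))

cross-fromℤ : ∀ a b → ↥ fromℤ a ℤ.* ↧ fromℤ b ≡ a ℤ.* + 1
cross-fromℤ a b = cong₂ ℤ._*_ (↥-fromℤ a) (↧-fromℤ b)

fromℤ-mono-≤ : ∀ {a b} → a ℤ.≤ b → fromℤ a ℚ.≤ fromℤ b
fromℤ-mono-≤ {a} {b} a≤b = ℚ.*≤* (subst₂ ℤ._≤_ (sym (cross-fromℤ a b)) (sym (cross-fromℤ b a))
  (ℤP.*-monoʳ-≤-nonNeg (+ 1) a≤b))

fromℤ-mono-< : ∀ {a b} → a ℤ.< b → fromℤ a ℚ.< fromℤ b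
fromℤ-mono-< {a} {b} a<b = ℚ.*<* (subst₂ ℤ._<_ (sym (cross-fromℤ a b)) (sym (cross-fromℤ b a))
  (ℤP.*-monoʳ-<-pos (+ 1) a<b))

fromℤ-*-/ : ∀ z n .{{_ : ℕ.NonZero n}} → fromℤ (+ n) ℚ.* (z / n) ≡ fromℤ z
fromℤ-*-/ z n@(suc n-1) = ℚP.toℚᵘ-injective (begin
  toℚᵘ (fromℤ (+ n) ℚ.* (z / n))          ≈⟨ ℚP.toℚᵘ-homo-* (fromℤ (+ n)) (z / n) ⟩
  toℚᵘ (fromℤ (+ n)) ℚᵘ.* toℚᵘ (z / n)    ≈⟨ ℚᵘP.*-cong (toℚᵘ-fromℤ (+ n)) (ℚP.toℚᵘ-fromℚᵘ (ℚᵘ.mkℚᵘ z n-1)) ⟩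
  ℚᵘ.mkℚᵘ (+ n) 0 ℚᵘ.* ℚᵘ.mkℚᵘ z n-1     ≈⟨ ℚᵘ.*≡* cross ⟩
  ℚᵘ.mkℚᵘ z 0                             ≈⟨ toℚᵘ-fromℤ z ⟨
  toℚᵘ (fromℤ z)                          ∎)
  where
  open ℚᵘP.≃-Reasoning
  cross : (+ n ℤ.* z) ℤ.* + 1 ≡ z ℤ.* + (1 ℕ.* n)
  cross rewrite ℕP.*-identityˡ n = trans (ℤP.*-identityʳ _) (ℤP.*-comm (+ n) z)

fromℤ-*-÷ : ∀ r s → s ≢ + 0 → fromℤ s ℚ.* (r ÷ s) ≡ fromℤ r
fromℤ-*-÷ r (+ zero)   s≢0 = ⊥-elim (s≢0 refl)
fromℤ-*-÷ r (+ suc n)  _   = fromℤ-*-/ r (suc n)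
fromℤ-*-÷ r -[1+ n ]   _   = begin
  fromℤ (ℤ.- + suc n) ℚ.* (ℤ.- r / suc n)    ≡⟨ cong (ℚ._* (ℤ.- r / suc n)) (fromℤ-homo‿- (+ suc n)) ⟩
  ℚ.- fromℤ (+ suc n) ℚ.* (ℤ.- r / suc n)    ≡⟨ ℚP.neg-distribˡ-* (fromℤ (+ suc n)) (ℤ.- r / suc n) ⟨
  ℚ.- (fromℤ (+ suc n) ℚ.* (ℤ.- r / suc n))  ≡⟨ cong ℚ.-_ (fromℤ-*-/ (ℤ.- r) (suc n)) ⟩
  ℚ.- fromℤ (ℤ.- r)                          ≡⟨ fromℤ-homo‿- (ℤ.- r) ⟨
  fromℤ (ℤ.- ℤ.- r)                          ≡⟨ cong fromℤ (ℤP.neg-involutive r) ⟩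
  fromℤ r                                    ∎
  where open ≡-Reasoning

fromℤ-*-cancelˡ : ∀ z {p q} → z ≢ + 0 → fromℤ z ℚ.* p ≡ fromℤ z ℚ.* q → p ≡ q
fromℤ-*-cancelˡ z {p} {q} z≢0 eq = begin
  p                      ≡⟨ ℚP.*-identityˡ p ⟨
  1ℚ ℚ.* p               ≡⟨ cong (ℚ._* p) (ℚP.*-inverseˡ (fromℤ z)) ⟨
  z⁻¹ ℚ.* fromℤ z ℚ.* p  ≡⟨ ℚP.*-assoc z⁻¹ (fromℤ z) p ⟩
  z⁻¹ ℚ.* (fromℤ z ℚ.* p) ≡⟨ cong (z⁻¹ ℚ.*_) eq ⟩
  z⁻¹ ℚ.* (fromℤ z ℚ.* q) ≡⟨ ℚP.*-assoc z⁻¹ (fromℤ z) q ⟨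
  z⁻¹ ℚ.* fromℤ z ℚ.* q  ≡⟨ cong (ℚ._* q) (ℚP.*-inverseˡ (fromℤ z)) ⟩
  1ℚ ℚ.* q               ≡⟨ ℚP.*-identityˡ q ⟩
  q                      ∎
  where
  open ≡-Reasoning
  instance
    fromℤ-z-nonZero : ℚ.NonZero (fromℤ z)
    fromℤ-z-nonZero = ℚ.≢-nonZero (λ e → z≢0 (fromℤ-injective e))
  z⁻¹ : ℚ
  z⁻¹ = ℚ.1/ fromℤ z

↧ₙ-/-∣ : ∀ z n .{{_ : ℕ.NonZero n}} → ↧ₙ (z / n) ℕD.∣ n
↧ₙ-/-∣ z n = ℕD.divides g (ℤP.+-injective (begin
  + n                         ≡⟨ ℚP.↧-/ z n ⟨
  ↧ (z / n) ℤ.* + g           ≡⟨ ℤP.pos-* (↧ₙ (z / n)) g ⟨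
  + (↧ₙ (z / n) ℕ.* g)        ≡⟨ cong +_ (ℕP.*-comm (↧ₙ (z / n)) g) ⟩
  + (g ℕ.* ↧ₙ (z / n))        ∎))
  where
  open ≡-Reasoning
  g : ℕ
  g = ℕG.gcd ∣ z ∣ n

↧ₙ-÷-∣ : ∀ r s → s ≢ + 0 → ↧ₙ (r ÷ s) ℕD.∣ ∣ s ∣
↧ₙ-÷-∣ r (+ zero)  s≢0 = ⊥-elim (s≢0 refl)
↧ₙ-÷-∣ r (+ suc n) _   = ↧ₙ-/-∣ r (suc n)
↧ₙ-÷-∣ r -[1+ n ]  _   = ↧ₙ-/-∣ (ℤ.- r) (suc n)

÷-cancel-common-factor : ∀ c r s → c ℤ.* s ≢ + 0 → (c ℤ.* r) ÷ (c ℤ.* s) ≡ r ÷ s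
÷-cancel-common-factor c r s cs≢0 = fromℤ-*-cancelˡ (c ℤ.* s) cs≢0 (begin
  fromℤ (c ℤ.* s) ℚ.* ((c ℤ.* r) ÷ (c ℤ.* s))  ≡⟨ fromℤ-*-÷ (c ℤ.* r) (c ℤ.* s) cs≢0 ⟩
  fromℤ (c ℤ.* r)                              ≡⟨ fromℤ-homo-* c r ⟩
  fromℤ c ℚ.* fromℤ r                          ≡⟨ cong (fromℤ c ℚ.*_) (fromℤ-*-÷ r s s≢0) ⟨
  fromℤ c ℚ.* (fromℤ s ℚ.* (r ÷ s))            ≡⟨ ℚP.*-assoc (fromℤ c) (fromℤ s) (r ÷ s) ⟨
  fromℤ c ℚ.* fromℤ s ℚ.* (r ÷ s)              ≡⟨ cong (ℚ._* (r ÷ s)) (fromℤ-homo-* c s) ⟨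
  fromℤ (c ℤ.* s) ℚ.* (r ÷ s)                  ∎)
  where
  open ≡-Reasoning
  s≢0 : s ≢ + 0
  s≢0 s≡0 = cs≢0 (trans (cong (c ℤ.*_) s≡0) (ℤP.*-zeroʳ c))

fromℤ-floor-≤ : ∀ p → fromℤ (floor p) ℚ.≤ p
fromℤ-floor-≤ p@(mkℚ n d-1 _) = ℚ.*≤* (subst₂ ℤ._≤_
  (sym (cong (ℤ._* d) (↥-fromℤ q)))
  (sym (trans (cong (n ℤ.*_) (↧-fromℤ q)) (ℤP.*-identityʳ n)))
  qd≤n)
  where
  d : ℤ
  d = + suc d-1
  q : ℤ
  q = n ℤ./ d
  qd≤n : q ℤ.* d ℤ.≤ n
  qd≤n = subst (q ℤ.* d ℤ.≤_) (sym (ℤD.a≡a%n+[a/n]*n n d)) (ℤP.i≤j+i _ (+ (n ℤ.% d)))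

<-fromℤ-floor+1 : ∀ p → p ℚ.< fromℤ (floor p ℤ.+ + 1)
<-fromℤ-floor+1 p@(mkℚ n d-1 _) = ℚ.*<* (subst₂ ℤ._<_
  (sym (trans (cong (n ℤ.*_) (↧-fromℤ (q ℤ.+ + 1))) (ℤP.*-identityʳ n)))
  (sym (cong (ℤ._* d) (↥-fromℤ (q ℤ.+ + 1))))
  n<[q+1]d)
  where
  d : ℤ
  d = + suc d-1
  q : ℤ
  q = n ℤ./ d
  identity : ∀ q d → d ℤ.+ q ℤ.* d ≡ (q ℤ.+ + 1) ℤ.* d
  identity = solve-∀
  n<[q+1]d : n ℤ.< (q ℤ.+ + 1) ℤ.* d
  n<[q+1]d = subst₂ ℤ._<_ (sym (ℤD.a≡a%n+[a/n]*n n d)) (identity q d)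
    (ℤP.+-monoˡ-< (q ℤ.* d) (ℤ.+<+ (ℤD.n%d<d n d)))

0<p+⌊1-p⌋ : ∀ p → 0ℚ ℚ.< p ℚ.+ fromℤ (floor (1ℚ ℚ.- p))
0<p+⌊1-p⌋ p = subst₂ ℚ._<_ (cancel p) (shift (fromℤ f) p)
  (ℚP.+-monoˡ-< (p ℚ.- 1ℚ) (subst (1ℚ ℚ.- p ℚ.<_) (fromℤ-homo-+ f (+ 1)) (<-fromℤ-floor+1 (1ℚ ℚ.- p))))
  where
  f : ℤ
  f = floor (1ℚ ℚ.- p)
  cancel : ∀ p → (1ℚ ℚ.- p) ℚ.+ (p ℚ.- 1ℚ) ≡ 0ℚ
  cancel = solve 1 (λ p → (con 1ℚ :- p) :+ (p :- con 1ℚ) := con 0ℚ) refl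
  shift : ∀ x p → (x ℚ.+ 1ℚ) ℚ.+ (p ℚ.- 1ℚ) ≡ p ℚ.+ x
  shift = solve 2 (λ x p → (x :+ con 1ℚ) :+ (p :- con 1ℚ) := p :+ x) refl

p+⌊1-p⌋≤1 : ∀ p → p ℚ.+ fromℤ (floor (1ℚ ℚ.- p)) ℚ.≤ 1ℚ
p+⌊1-p⌋≤1 p = subst₂ ℚ._≤_ (ℚP.+-comm (fromℤ (floor (1ℚ ℚ.- p))) p) (cancel p)
  (ℚP.+-monoˡ-≤ p (fromℤ-floor-≤ (1ℚ ℚ.- p)))
  where
  cancel : ∀ p → (1ℚ ℚ.- p) ℚ.+ p ≡ 1ℚ
  cancel = solve 1 (λ p → (con 1ℚ :- p) :+ p := con 1ℚ) refl

IsD⇒bounds : ∀ {m α δ} .{{_ : ℕ.NonZero m}} → IsD m α δ →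
  (0ℚ ℚ.< δ ℚ.+ floor (1ℚ ℚ.- α) / m) × (δ ℚ.+ floor (1ℚ ℚ.- α) / m ℚ.≤ 1ℚ)
IsD⇒bounds {m} {α} {δ} (_ , k , k<m , mδ-α≡k) =
  ℚP.*-cancelˡ-<-nonNeg M {{ℚP.pos⇒nonNeg M}} (begin-strict
    M ℚ.* 0ℚ         ≡⟨ ℚP.*-zeroʳ M ⟩
    0ℚ ℚ.+ 0ℚ        <⟨ ℚP.+-mono-<-≤ (0<p+⌊1-p⌋ α) (fromℤ-mono-≤ (ℤ.+≤+ (ℕ.z≤n {k}))) ⟩
    (α ℚ.+ fromℤ f) ℚ.+ K  ≡⟨ scaled ⟨
    M ℚ.* γ          ∎)
  , ℚP.*-cancelˡ-≤-pos M (begin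
    M ℚ.* γ          ≡⟨ scaled ⟩
    (α ℚ.+ fromℤ f) ℚ.+ K  ≤⟨ ℚP.+-monoˡ-≤ K (p+⌊1-p⌋≤1 α) ⟩
    1ℚ ℚ.+ K         ≡⟨ fromℤ-homo-+ (+ 1) (+ k) ⟨
    fromℤ (+ suc k)  ≤⟨ fromℤ-mono-≤ (ℤ.+≤+ k<m) ⟩
    M                ≡⟨ ℚP.*-identityʳ M ⟨
    M ℚ.* 1ℚ         ∎)
  where
  open ℚP.≤-Reasoning
  M : ℚ
  M = fromℤ (+ m)
  K : ℚ
  K = fromℤ (+ k)
  f : ℤ
  f = floor (1ℚ ℚ.- α)
  γ : ℚ
  γ = δ ℚ.+ f / m
  instance
    M-positive : ℚ.Positive M
    M-positive = ℚ.positive (fromℤ-mono-< (ℤ.+<+ (ℕ.>-nonZero⁻¹ m)))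
  regroup : ∀ x a y → (x ℚ.- a) ℚ.+ a ℚ.+ y ≡ x ℚ.+ y
  regroup = solve 3 (λ x a y → (x :- a) :+ a :+ y := x :+ y) refl
  swap : ∀ k a y → (k ℚ.+ a) ℚ.+ y ≡ (a ℚ.+ y) ℚ.+ k
  swap = solve 3 (λ k a y → (k :+ a) :+ y := (a :+ y) :+ k) refl
  scaled : M ℚ.* γ ≡ (α ℚ.+ fromℤ f) ℚ.+ K
  scaled = begin-equality
    M ℚ.* (δ ℚ.+ f / m)                    ≡⟨ ℚP.*-distribˡ-+ M δ (f / m) ⟩
    M ℚ.* δ ℚ.+ M ℚ.* (f / m)              ≡⟨ cong (M ℚ.* δ ℚ.+_) (fromℤ-*-/ f m) ⟩
    M ℚ.* δ ℚ.+ fromℤ f                    ≡⟨ regroup (M ℚ.* δ) α (fromℤ f) ⟨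
    (M ℚ.* δ ℚ.- α) ℚ.+ α ℚ.+ fromℤ f      ≡⟨ cong (λ x → x ℚ.+ α ℚ.+ fromℤ f) mδ-α≡k ⟩
    (K ℚ.+ α) ℚ.+ fromℤ f                  ≡⟨ swap K α (fromℤ f) ⟩
    (α ℚ.+ fromℤ f) ℚ.+ K                  ∎

invertible-mod : ∀ s m → Coprime ∣ s ∣ m → Σ ℤ λ u → Σ ℤ λ v → u ℤ.* s ≡ + 1 ℤ.+ v ℤ.* + m
invertible-mod (+ a) m cop with ℕC.coprime-Bézout cop
... | ℕG.Bézout.+- x y eq = + x , + y , (begin
  + x ℤ.* + a         ≡⟨ ℤP.pos-* x a ⟨
  + (x ℕ.* a)         ≡⟨ cong +_ eq ⟨
  + (1 ℕ.+ y ℕ.* m)   ≡⟨ cong (ℤ._+_ (+ 1)) (ℤP.pos-* y m) ⟩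
  + 1 ℤ.+ + y ℤ.* + m ∎)
  where open ≡-Reasoning
... | ℕG.Bézout.-+ x y eq = ℤ.- + x , ℤ.- + y , (begin
  ℤ.- + x ℤ.* + a                  ≡⟨ flip (+ x) (+ a) ⟩
  + 1 ℤ.+ ℤ.- (+ 1 ℤ.+ + x ℤ.* + a) ≡⟨ cong (λ z → + 1 ℤ.+ ℤ.- (+ 1 ℤ.+ z)) (ℤP.pos-* x a) ⟨
  + 1 ℤ.+ ℤ.- + (1 ℕ.+ x ℕ.* a)    ≡⟨ cong (λ z → + 1 ℤ.+ ℤ.- + z) eq ⟩
  + 1 ℤ.+ ℤ.- + (y ℕ.* m)          ≡⟨ cong (λ z → + 1 ℤ.+ ℤ.- z) (ℤP.pos-* y m) ⟩
  + 1 ℤ.+ ℤ.- (+ y ℤ.* + m)        ≡⟨ cong (ℤ._+_ (+ 1)) (ℤP.neg-distribˡ-* (+ y) (+ m)) ⟩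
  + 1 ℤ.+ ℤ.- + y ℤ.* + m          ∎)
  where
  open ≡-Reasoning
  flip : ∀ x a → ℤ.- x ℤ.* a ≡ + 1 ℤ.+ ℤ.- (+ 1 ℤ.+ x ℤ.* a)
  flip = solve-∀
invertible-mod -[1+ a ] m cop with invertible-mod (+ suc a) m cop
... | u , v , eq = ℤ.- u , v , trans (negate u (+ suc a)) eq
  where
  negate : ∀ u a → ℤ.- u ℤ.* ℤ.- a ≡ u ℤ.* a
  negate = solve-∀

linear-congruence : ∀ s m .{{_ : ℕ.NonZero m}} → Coprime ∣ s ∣ m → ∀ r →
  Σ ℕ λ k → k ℕ.< m × Σ ℤ λ t → + k ℤ.* s ≡ + m ℤ.* t ℤ.- r
linear-congruence s m cop r with invertible-mod s m cop
... | u , v , us≡1+vm = k , ℤD.n%d<d a (+ m) , t , (begin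
  + k ℤ.* s                                  ≡⟨ cong (ℤ._* s) (k≡a-qm (+ k) (ℤD.a≡a%n+[a/n]*n a (+ m))) ⟩
  (a ℤ.- q ℤ.* + m) ℤ.* s                    ≡⟨ expand r u q (+ m) s ⟩
  ℤ.- r ℤ.* (u ℤ.* s) ℤ.- q ℤ.* + m ℤ.* s    ≡⟨ cong (λ w → ℤ.- r ℤ.* w ℤ.- q ℤ.* + m ℤ.* s) us≡1+vm ⟩
  ℤ.- r ℤ.* (+ 1 ℤ.+ v ℤ.* + m) ℤ.- q ℤ.* + m ℤ.* s ≡⟨ collect r v q (+ m) s ⟩
  + m ℤ.* t ℤ.- r                            ∎)
  where
  open ≡-Reasoning
  a : ℤ
  a = ℤ.- r ℤ.* u
  k : ℕ
  k = a ℤ.% + m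
  q : ℤ
  q = a ℤ./ + m
  t : ℤ
  t = ℤ.- (r ℤ.* v) ℤ.- q ℤ.* s
  k≡a-qm : ∀ k → a ≡ k ℤ.+ q ℤ.* + m → k ≡ a ℤ.- q ℤ.* + m
  k≡a-qm k a≡k+qm = trans (cancel k (q ℤ.* + m)) (cong (ℤ._- q ℤ.* + m) (sym a≡k+qm))
    where
    cancel : ∀ k x → k ≡ (k ℤ.+ x) ℤ.- x
    cancel = solve-∀
  expand : ∀ r u q m s → (ℤ.- r ℤ.* u ℤ.- q ℤ.* m) ℤ.* s ≡ ℤ.- r ℤ.* (u ℤ.* s) ℤ.- q ℤ.* m ℤ.* s
  expand = solve-∀
  collect : ∀ r v q m s → ℤ.- r ℤ.* (+ 1 ℤ.+ v ℤ.* m) ℤ.- q ℤ.* m ℤ.* s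
                        ≡ m ℤ.* (ℤ.- (r ℤ.* v) ℤ.- q ℤ.* s) ℤ.- r
  collect = solve-∀

IsD-÷-exists : ∀ {m} .{{_ : ℕ.NonZero m}} r s → s ≢ + 0 → Coprime ∣ s ∣ m → Σ ℚ (IsD m (r ÷ s))
IsD-÷-exists {m} r s s≢0 cop with linear-congruence s m cop r
... | k , k<m , t , ks≡mt-r = t ÷ s , ↧ₙ-coprime , k , k<m , fromℤ-*-cancelˡ s s≢0 (begin
  S ℚ.* (M ℚ.* (t ÷ s) ℚ.- r ÷ s)         ≡⟨ distribute S M (t ÷ s) (r ÷ s) ⟩
  M ℚ.* (S ℚ.* (t ÷ s)) ℚ.- S ℚ.* (r ÷ s) ≡⟨ cong₂ (λ x y → M ℚ.* x ℚ.- y) (fromℤ-*-÷ t s s≢0) (fromℤ-*-÷ r s s≢0) ⟩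
  M ℚ.* fromℤ t ℚ.- fromℤ r               ≡⟨ cong₂ ℚ._+_ (fromℤ-homo-* (+ m) t) (fromℤ-homo‿- r) ⟨
  fromℤ (+ m ℤ.* t) ℚ.+ fromℤ (ℤ.- r)     ≡⟨ fromℤ-homo-+ (+ m ℤ.* t) (ℤ.- r) ⟨
  fromℤ (+ m ℤ.* t ℤ.- r)                 ≡⟨ cong fromℤ ks≡mt-r ⟨
  fromℤ (+ k ℤ.* s)                       ≡⟨ cong fromℤ (ℤP.*-comm (+ k) s) ⟩
  fromℤ (s ℤ.* + k)                       ≡⟨ fromℤ-homo-* s (+ k) ⟩
  S ℚ.* fromℤ (+ k)                       ∎)
  where
  open ≡-Reasoning
  S : ℚ
  S = fromℤ s
  M : ℚ
  M = fromℤ (+ m)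
  ↧ₙ-coprime : Coprime (↧ₙ (t ÷ s)) m
  ↧ₙ-coprime (d∣↧ₙ , d∣m) = cop (ℕD.∣-trans d∣↧ₙ (↧ₙ-÷-∣ t s s≢0) , d∣m)
  distribute : ∀ S M δ α → S ℚ.* (M ℚ.* δ ℚ.- α) ≡ M ℚ.* (S ℚ.* δ) ℚ.- S ℚ.* α
  distribute = solve 4 (λ S M δ α → S :* (M :* δ :- α) := M :* (S :* δ) :- S :* α) refl

positive-cofactor : ∀ c b′ → + 1 ℤ.≤ + c ℤ.* b′ → Σ ℕ λ n → b′ ≡ + suc n
positive-cofactor zero    b′        (ℤ.+≤+ ())
positive-cofactor (suc c) (+ zero)  1≤c0 with subst (+ 1 ℤ.≤_) (ℤP.*-zeroʳ (+ suc c)) 1≤c0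
... | ℤ.+≤+ ()
positive-cofactor (suc c) (+ suc n) _ = n , refl
positive-cofactor (suc c) -[1+ n ]  ()

gcd[gcd[i,j],k]∣i : ∀ i j k → gcd (gcd i j) k ℤS.∣ i
gcd[gcd[i,j],k]∣i i j k = ℤS.∣ᵤ⇒∣ (ℕD.∣-trans (gcd[i,j]∣i (gcd i j) k) (gcd[i,j]∣i i j))

lemma3p7 : (r s b : ℤ) → s ≢ + 0 → + 1 ℤ.≤ b →
    (b′ s′ : ℤ) → b ≡ gcd (gcd r s) b ℤ.* b′ → s ≡ gcd (gcd r s) b ℤ.* s′ →
    gcd s′ b′ ≡ + 1 →
    Σ ℚ (λ δ → IsD ∣ b′ ∣ (r ÷ s) δ)
    × ((δ : ℚ) → IsD ∣ b′ ∣ (r ÷ s) δ →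
        (0ℚ ℚ.< δ ℚ.+ (floor (1ℚ ℚ.- (r ÷ s)) ÷ b′))
        × (δ ℚ.+ (floor (1ℚ ℚ.- (r ÷ s)) ÷ b′) ℚ.≤ 1ℚ))
lemma3p7 r s b s≢0 1≤b b′ s′ eb es g
  with positive-cofactor ∣ gcd (gcd r s) b ∣ b′ (subst (+ 1 ℤ.≤_) eb 1≤b)
     | gcd[gcd[i,j],k]∣i r s b
... | n , refl | ℤS.divides r′ r≡r′c = subst (λ α → Σ ℚ (IsD (suc n) α)) (sym r÷s≡r′÷s′)
      (IsD-÷-exists r′ s′ s′≢0 (ℕC.gcd≡1⇒coprime (ℤP.+-injective g)))
    , λ _ → IsD⇒bounds
  where
  c : ℤ
  c = gcd (gcd r s) b
  s′≢0 : s′ ≢ + 0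
  s′≢0 s′≡0 = s≢0 (trans es (trans (cong (c ℤ.*_) s′≡0) (ℤP.*-zeroʳ c)))
  r÷s≡r′÷s′ : r ÷ s ≡ r′ ÷ s′
  r÷s≡r′÷s′ = trans (cong₂ _÷_ (trans r≡r′c (ℤP.*-comm r′ c)) es)
                    (÷-cancel-common-factor c r′ s′ (λ cs′≡0 → s≢0 (trans es cs′≡0)))
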